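{- $\mathbf{LV}$ is the logic preserving degrees of truth of the variety of $\mathsf V$-algebras.
   Context: $\mathbf{LV}$ is the smallest finitary consequence relation in the language $\{\land,\lor,\to,\mathbin{\Box\!\!\rightarrow},0,1\}$ containing classical propositional axioms and (L1) $\varphi\mathbin{\Box\!\!\rightarrow}\varphi$, (L2) $((\varphi\mathbin{\Box\!\!\rightarrow}\psi)\wedge(\psi\mathbin{\Box\!\!\rightarrow}\varphi))\to((\varphi\mathbin{\Box\!\!\rightarrow}\gamma)\leftrightarrow(\psi\mathbin{\Box\!\!\rightarrow}\gamma))$, (L3) $((\varphi\vee\psi)\mathbin{\Box\!\!\rightarrow}\varphi)\vee((\varphi\vee\psi)\mathbin{\Box\!\!\rightarrow}\psi)\vee(((\varphi\vee\psi)\mathbin{\Box\!\!\rightarrow}\gamma)\leftrightarrow((\varphi\mathbin{\Box\!\!\rightarrow}\gamma)\wedge(\psi\mathbin{\Box\!\!\rightarrow}\gamma)))$, (L4) $(\varphi\mathbin{\Box\!\!\rightarrow}(\psi\land\gamma))\leftrightarrow((\varphi\mathbin{\Box\!\!\rightarrow}\psi)\land(\varphi\mathbin{\Box\!\!\rightarrow}\gamma))$, closed under modus ponens and the weak rule: if $\vdash\varphi\to\psi$ then $\vdash(\gamma\mathbin{\Box\!\!\rightarrow}\varphi)\to(\gamma\mathbin{\Box\!\!\rightarrow}\psi)$. A $\mathsf V$-algebra is a Boolean algebra with a binary operation $\mathbin{\Box\!\!\rightarrow}$ satisfying the equational translations $\varphi\approx 1$ of (L1)–(L3) (with (L2) as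 $((x\mathbin{\Box\!\!\rightarrow}y)\wedge(y\mathbin{\Box\!\!\rightarrow}x))\le((x\mathbin{\Box\!\!\rightarrow}z)\leftrightarrow(y\mathbin{\Box\!\!\rightarrow}z))$) and $x\mathbin{\Box\!\!\rightarrow}(y\wedge z)=(x\mathbin{\Box\!\!\rightarrow}y)\wedge(x\mathbin{\Box\!\!\rightarrow}z)$. The logic preserving degrees of truth of a class $\mathsf K$ of ordered algebras is: $\Gamma\vdash^{\le}_{\mathsf K}\varphi$ iff for all $\mathbf A\in\mathsf K$, assignments $h$ and $a\in A$, if $a\le h(\gamma)$ for every $\gamma\in\Gamma$ then $a\le h(\varphi)$. -}

module Defs where

open import Level using (Level; _⊔_; 0ℓ) renaming (suc to lsuc)
open import Data.Nat using (ℕ)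
open import Data.Bool using (Bool; true; false; not) renaming (_∧_ to _∧ᵇ_; _∨_ to _∨ᵇ_)
open import Relation.Binary.PropositionalEquality using (_≡_)
open import Relation.Unary using (Pred)
open import Algebra.Lattice.Bundles using (BooleanAlgebra)

infixr 7 _∧'_
infixr 6 _∨'_
infixr 5 _⇒_
infixr 5 _□→_
data Formula : Set where
  var  : ℕ → Formula
  _∧'_ : Formula → Formula → Formula
  _∨'_ : Formula → Formula → Formula
  _⇒_  : Formula → Formula → Formula
  _□→_ : Formula → Formula → Formula
  𝟘    : Formula
  𝟙    : Formula

_⇔_ : Formula → Formula → Formula
φ ⇔ ψ = (φ ⇒ ψ) ∧' (ψ ⇒ φ)

-- Classical propositional axioms: all substitution instances of classical
-- tautologies, i.e. formulas true under every two-valued evaluation that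
-- treats variables and □→-formulas as atoms.
evalB : (Formula → Bool) → Formula → Bool
evalB v (var n)   = v (var n)
evalB v (φ ∧' ψ)  = evalB v φ ∧ᵇ evalB v ψ
evalB v (φ ∨' ψ)  = evalB v φ ∨ᵇ evalB v ψ
evalB v (φ ⇒ ψ)   = not (evalB v φ) ∨ᵇ evalB v ψ
evalB v (φ □→ ψ)  = v (φ □→ ψ)
evalB v 𝟘         = false
evalB v 𝟙         = true

Tautology : Formula → Set
Tautology φ = (v : Formula → Bool) → evalB v φ ≡ true

∅ : Pred Formula 0ℓ
∅ _ = Data.Empty.⊥ where import Data.Empty

infix 3 _⊢_
data _⊢_ (Γ : Pred Formula 0ℓ) : Formula → Set where
  hyp  : ∀ {φ} → Γ φ → Γ ⊢ φ
  taut : ∀ {φ} → Tautology φ → Γ ⊢ φ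
  L1   : ∀ φ → Γ ⊢ φ □→ φ
  L2   : ∀ φ ψ γ → Γ ⊢ ((φ □→ ψ) ∧' (ψ □→ φ)) ⇒ ((φ □→ γ) ⇔ (ψ □→ γ))
  L3   : ∀ φ ψ γ → Γ ⊢ (((φ ∨' ψ) □→ φ) ∨' ((φ ∨' ψ) □→ ψ))
                      ∨' (((φ ∨' ψ) □→ γ) ⇔ ((φ □→ γ) ∧' (ψ □→ γ)))
  L4   : ∀ φ ψ γ → Γ ⊢ (φ □→ (ψ ∧' γ)) ⇔ ((φ □→ ψ) ∧' (φ □→ γ))
  mp   : ∀ {φ ψ} → Γ ⊢ φ → Γ ⊢ φ ⇒ ψ → Γ ⊢ ψ
  weak : ∀ {φ ψ} γ → ∅ ⊢ φ ⇒ ψ → Γ ⊢ (γ □→ φ) ⇒ (γ □→ ψ)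

record VAlgebra (c ℓ : Level) : Set (lsuc (c ⊔ ℓ)) where
  field
    boolAlg : BooleanAlgebra c ℓ
  open BooleanAlgebra boolAlg public
  infixr 5 _⟶_
  _⟶_ : Carrier → Carrier → Carrier
  x ⟶ y = (¬ x) ∨ y
  _⟷_ : Carrier → Carrier → Carrier
  x ⟷ y = (x ⟶ y) ∧ (y ⟶ x)
  _≤_ : Carrier → Carrier → Set ℓ
  x ≤ y = (x ∧ y) ≈ x
  field
    _⊡_     : Carrier → Carrier → Carrier
    ⊡-cong  : ∀ {x x' y y'} → x ≈ x' → y ≈ y' → (x ⊡ y) ≈ (x' ⊡ y')
    V1      : ∀ x → (x ⊡ x) ≈ ⊤
    V2      : ∀ x y z → ((x ⊡ y) ∧ (y ⊡ x)) ≤ ((x ⊡ z) ⟷ (y ⊡ z))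
    V3      : ∀ x y z → ((((x ∨ y) ⊡ x) ∨ ((x ∨ y) ⊡ y))
                          ∨ (((x ∨ y) ⊡ z) ⟷ ((x ⊡ z) ∧ (y ⊡ z)))) ≈ ⊤
    V4      : ∀ x y z → (x ⊡ (y ∧ z)) ≈ ((x ⊡ y) ∧ (x ⊡ z))

module _ {c ℓ : Level} (A : VAlgebra c ℓ) where
  open VAlgebra A
  ⟦_⟧ : Formula → (ℕ → Carrier) → Carrier
  ⟦ var n ⟧ h   = h n
  ⟦ φ ∧' ψ ⟧ h  = ⟦ φ ⟧ h ∧ ⟦ ψ ⟧ h
  ⟦ φ ∨' ψ ⟧ h  = ⟦ φ ⟧ h ∨ ⟦ ψ ⟧ h
  ⟦ φ ⇒ ψ ⟧ h   = ⟦ φ ⟧ h ⟶ ⟦ ψ ⟧ h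
  ⟦ φ □→ ψ ⟧ h  = ⟦ φ ⟧ h ⊡ ⟦ ψ ⟧ h
  ⟦ 𝟘 ⟧ h       = ⊥
  ⟦ 𝟙 ⟧ h       = ⊤

_⊨≤[_,_]_ : Pred Formula 0ℓ → (c ℓ : Level) → Formula → Set (lsuc (c ⊔ ℓ))
Γ ⊨≤[ c , ℓ ] φ = (A : VAlgebra c ℓ) (h : ℕ → VAlgebra.Carrier A) (a : VAlgebra.Carrier A)
  → (∀ γ → Γ γ → VAlgebra._≤_ A a (⟦ A ⟧ γ h)) → VAlgebra._≤_ A a (⟦ A ⟧ φ h)

{-# OPTIONS --safe #-}

-- Each axiom takes the value ⊤ in every V-algebra, modus ponens preserves lying above
-- a given element, and the rule is only applied to theorems, which evaluate to ⊤, so it follows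
-- from the monotonicity of □→ in its second argument (a consequence of V4). For the classical
-- axioms: in a Boolean algebra ⊤ is the join of the minterms over the atoms of a formula, and
-- below each minterm the formula's value is the literal its truth table predicts.
--
-- Represent the degree a by a fresh variable p and each premise γ by p → γ. In the
-- Lindenbaum algebra of the consequence relation in which the rule may be applied to any
-- consequence of these premises, [p] lies below every premise, so p → φ is derivable there. That
-- derivation uses finitely many premises; substituting their conjunction χ for p turns it into an
-- LV-proof of χ → φ, while Γ ⊢ χ.

module Submission where

open import Defs
open import Level using (Level; 0ℓ; Lift; lift; lower)
open import Algebra.Lattice.Bundles using (BooleanAlgebra)
import Algebra.Lattice.Properties.BooleanAlgebra as BooleanAlgebraProperties
import Algebra.Lattice.Properties.Lattice as LatticeProperties
open import Data.Bool using (Bool; true; false; not; T; if_then_else_)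
  renaming (_∧_ to _∧ᵇ_; _∨_ to _∨ᵇ_)
open import Data.Bool.Properties using (T-∧; T-≡)
import Data.Empty as Empty
open import Data.List using (List; []; _∷_; _++_)
open import Data.List.Membership.Propositional using (_∈_)
open import Data.List.Membership.Propositional.Properties using (∈-++⁺ˡ; ∈-++⁺ʳ)
open import Data.List.Relation.Unary.Any using (here; there)
open import Data.Nat as ℕ using (ℕ; zero; suc)
open import Data.Product using (_×_; _,_; proj₁; proj₂; uncurry; Σ-syntax)
import Data.Unit as Unit
open import Data.Vec using (Vec; []; _∷_; map)
open import Function using (_∘_; Equivalence)
open import Relation.Binary.Definitions using (DecidableEquality)
import Relation.Binary.Lattice as OrderLattice
import Relation.Binary.Lattice.Properties.MeetSemilattice as MeetSemilatticeProperties
open import Relation.Binary.PropositionalEquality as ≡ using (_≡_)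
open import Relation.Nullary using (contradiction)
open import Relation.Nullary.Decidable using (Dec; yes; no; does; map′; _×-dec_)
open import Relation.Unary using (Pred; _⊆_)

tag : Formula → ℕ
tag (var _)  = 0
tag (_ ∧' _) = 1
tag (_ ∨' _) = 2
tag (_ ⇒ _)  = 3
tag (_ □→ _) = 4
tag 𝟘        = 5
tag 𝟙        = 6

infix 4 _≟_
_≟_ : DecidableEquality Formula

-- Comparing outermost constructors first leaves only the diagonal cases.
≟-sameTag : ∀ φ ψ → tag φ ≡ tag ψ → Dec (φ ≡ ψ)
≟-sameTag (var m) (var n) ≡.refl =
  map′ (≡.cong var) (λ { ≡.refl → ≡.refl }) (m ℕ.≟ n)
≟-sameTag (φ ∧' ψ) (φ' ∧' ψ') ≡.refl =
  map′ (uncurry (≡.cong₂ _∧'_)) (λ { ≡.refl → ≡.refl , ≡.refl }) (φ ≟ φ' ×-dec ψ ≟ ψ')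
≟-sameTag (φ ∨' ψ) (φ' ∨' ψ') ≡.refl =
  map′ (uncurry (≡.cong₂ _∨'_)) (λ { ≡.refl → ≡.refl , ≡.refl }) (φ ≟ φ' ×-dec ψ ≟ ψ')
≟-sameTag (φ ⇒ ψ) (φ' ⇒ ψ') ≡.refl =
  map′ (uncurry (≡.cong₂ _⇒_)) (λ { ≡.refl → ≡.refl , ≡.refl }) (φ ≟ φ' ×-dec ψ ≟ ψ')
≟-sameTag (φ □→ ψ) (φ' □→ ψ') ≡.refl =
  map′ (uncurry (≡.cong₂ _□→_)) (λ { ≡.refl → ≡.refl , ≡.refl }) (φ ≟ φ' ×-dec ψ ≟ ψ')
≟-sameTag 𝟘 𝟘 ≡.refl = yes ≡.refl
≟-sameTag 𝟙 𝟙 ≡.refl = yes ≡.refl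

φ ≟ ψ with tag φ ℕ.≟ tag ψ
... | yes tags≡ = ≟-sameTag φ ψ tags≡
... | no  tags≢ = no (tags≢ ∘ ≡.cong tag)

atoms : Formula → List Formula
atoms (var n)  = var n ∷ []
atoms (φ ∧' ψ) = atoms φ ++ atoms ψ
atoms (φ ∨' ψ) = atoms φ ++ atoms ψ
atoms (φ ⇒ ψ)  = atoms φ ++ atoms ψ
atoms (φ □→ ψ) = (φ □→ ψ) ∷ []
atoms 𝟘        = []
atoms 𝟙        = []

_[_≔_] : (Formula → Bool) → Formula → Bool → Formula → Bool
(v [ α ≔ b ]) β = if does (β ≟ α) then b else v β

sub : (ℕ → Formula) → Formula → Formula
sub σ (var n)  = σ n
sub σ (φ ∧' ψ) = sub σ φ ∧' sub σ ψ
sub σ (φ ∨' ψ) = sub σ φ ∨' sub σ ψ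
sub σ (φ ⇒ ψ)  = sub σ φ ⇒ sub σ ψ
sub σ (φ □→ ψ) = sub σ φ □→ sub σ ψ
sub σ 𝟘        = 𝟘
sub σ 𝟙        = 𝟙

evalB-sub : ∀ σ v φ → evalB v (sub σ φ) ≡ evalB (evalB v ∘ sub σ) φ
evalB-sub σ v (var n)  = ≡.refl
evalB-sub σ v (φ ∧' ψ) = ≡.cong₂ _∧ᵇ_ (evalB-sub σ v φ) (evalB-sub σ v ψ)
evalB-sub σ v (φ ∨' ψ) = ≡.cong₂ _∨ᵇ_ (evalB-sub σ v φ) (evalB-sub σ v ψ)
evalB-sub σ v (φ ⇒ ψ)  = ≡.cong₂ (λ a b → not a ∨ᵇ b) (evalB-sub σ v φ) (evalB-sub σ v ψ)
evalB-sub σ v (φ □→ ψ) = ≡.refl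
evalB-sub σ v 𝟘        = ≡.refl
evalB-sub σ v 𝟙        = ≡.refl

Tautology-sub : ∀ σ {φ} → Tautology φ → Tautology (sub σ φ)
Tautology-sub σ {φ} ⊨φ v = ≡.trans (evalB-sub σ v φ) (⊨φ (evalB v ∘ sub σ))

↑_ : Formula → Formula
↑_ = sub (var ∘ suc)

fill : Formula → ℕ → Formula
fill θ zero    = θ
fill θ (suc n) = var n

fill-↑ : ∀ θ φ → sub (fill θ) (↑ φ) ≡ φ
fill-↑ θ (var n)  = ≡.refl
fill-↑ θ (φ ∧' ψ) = ≡.cong₂ _∧'_ (fill-↑ θ φ) (fill-↑ θ ψ)
fill-↑ θ (φ ∨' ψ) = ≡.cong₂ _∨'_ (fill-↑ θ φ) (fill-↑ θ ψ)
fill-↑ θ (φ ⇒ ψ)  = ≡.cong₂ _⇒_ (fill-↑ θ φ) (fill-↑ θ ψ)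
fill-↑ θ (φ □→ ψ) = ≡.cong₂ _□→_ (fill-↑ θ φ) (fill-↑ θ ψ)
fill-↑ θ 𝟘        = ≡.refl
fill-↑ θ 𝟙        = ≡.refl

BoxFree : Formula → Set
BoxFree (var n)  = Unit.⊤
BoxFree (φ ∧' ψ) = BoxFree φ × BoxFree ψ
BoxFree (φ ∨' ψ) = BoxFree φ × BoxFree ψ
BoxFree (φ ⇒ ψ)  = BoxFree φ × BoxFree ψ
BoxFree (φ □→ ψ) = Empty.⊥
BoxFree 𝟘        = Unit.⊤
BoxFree 𝟙        = Unit.⊤

evalB-boxFree : ∀ {v w} → (∀ n → v (var n) ≡ w (var n)) → ∀ φ → BoxFree φ → evalB v φ ≡ evalB w φ
evalB-boxFree v≗w (var n)  _       = v≗w n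
evalB-boxFree v≗w (φ ∧' ψ) (p , q) = ≡.cong₂ _∧ᵇ_ (evalB-boxFree v≗w φ p) (evalB-boxFree v≗w ψ q)
evalB-boxFree v≗w (φ ∨' ψ) (p , q) = ≡.cong₂ _∨ᵇ_ (evalB-boxFree v≗w φ p) (evalB-boxFree v≗w ψ q)
evalB-boxFree v≗w (φ ⇒ ψ)  (p , q) =
  ≡.cong₂ (λ a b → not a ∨ᵇ b) (evalB-boxFree v≗w φ p) (evalB-boxFree v≗w ψ q)
evalB-boxFree v≗w 𝟘        _       = ≡.refl
evalB-boxFree v≗w 𝟙        _       = ≡.refl

⟨_⟩ : ∀ {k} → Vec Formula k → ℕ → Formula
⟨ [] ⟩     n       = 𝟘
⟨ x ∷ xs ⟩ zero    = x
⟨ x ∷ xs ⟩ (suc n) = ⟨ xs ⟩ n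

⌜_⌝ : Bool → Formula
⌜ true ⌝  = 𝟙
⌜ false ⌝ = 𝟘

evalB-⌜⌝ : ∀ w b → evalB w ⌜ b ⌝ ≡ b
evalB-⌜⌝ w true  = ≡.refl
evalB-⌜⌝ w false = ≡.refl

evalB-⟨⌜⌝⟩ : ∀ {k} w v (xs : Vec Formula k) n
           → evalB w (⟨ map ⌜_⌝ (map (evalB v) xs) ⟩ n) ≡ evalB v (⟨ xs ⟩ n)
evalB-⟨⌜⌝⟩ w v []       n       = ≡.refl
evalB-⟨⌜⌝⟩ w v (x ∷ xs) zero    = evalB-⌜⌝ w (evalB v x)
evalB-⟨⌜⌝⟩ w v (x ∷ xs) (suc n) = evalB-⟨⌜⌝⟩ w v xs n

allBitVectors : ∀ k → (Vec Bool k → Bool) → Bool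
allBitVectors zero    f = f []
allBitVectors (suc k) f = allBitVectors k (f ∘ (true ∷_)) ∧ᵇ allBitVectors k (f ∘ (false ∷_))

allBitVectors-sound : ∀ k f → T (allBitVectors k f) → ∀ bs → T (f bs)
allBitVectors-sound zero    f all []       = all
allBitVectors-sound (suc k) f all (b ∷ bs) = allBitVectors-sound k (f ∘ (b ∷_)) (half b) bs
  where
  halves : T (allBitVectors k (f ∘ (true ∷_))) × T (allBitVectors k (f ∘ (false ∷_)))
  halves = Equivalence.to T-∧ all
  half : ∀ b → T (allBitVectors k (f ∘ (b ∷_)))
  half true  = proj₁ halves
  half false = proj₂ halves

truthTableValid : ℕ → Formula → Bool
truthTableValid k P = allBitVectors k (λ bs → evalB (λ _ → false) (sub ⟨ map ⌜_⌝ bs ⟩ P))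

-- For a concrete box-free skeleton P both implicit arguments compute to ⊤ and are inferred, so
-- instances of P are proved by evaluating its truth table.
tautology : ∀ {k} P (xs : Vec Formula k) {_ : BoxFree P} {_ : T (truthTableValid k P)}
          → Tautology (sub ⟨ xs ⟩ P)
tautology {k} P xs {boxFree} {table} v = begin
  evalB v (sub ⟨ xs ⟩ P)          ≡⟨ evalB-sub ⟨ xs ⟩ v P ⟩
  evalB (evalB v ∘ sub ⟨ xs ⟩) P  ≡⟨ evalB-boxFree (≡.sym ∘ evalB-⟨⌜⌝⟩ w v xs) P boxFree ⟩
  evalB (evalB w ∘ sub ⟨ bits ⟩) P ≡⟨ evalB-sub ⟨ bits ⟩ w P ⟨
  evalB w (sub ⟨ bits ⟩ P)        ≡⟨ Equivalence.to T-≡ (allBitVectors-sound k _ table (map (evalB v) xs)) ⟩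
  true                            ∎
  where
  open ≡.≡-Reasoning
  w : Formula → Bool
  w _ = false
  bits : Vec Formula k
  bits = map ⌜_⌝ (map (evalB v) xs)

p₀ p₁ p₂ p₃ : Formula
p₀ = var 0
p₁ = var 1
p₂ = var 2
p₃ = var 3

module BooleanOrder {c ℓ : Level} (B : BooleanAlgebra c ℓ) where
  open BooleanAlgebra B
  open BooleanAlgebraProperties B using (∧-identityʳ; ∧-identityˡ; ∨-identityˡ)
  open LatticeProperties lattice public using (poset)
  open LatticeProperties lattice using (∨-∧-orderTheoreticLattice)
  open OrderLattice.Lattice ∨-∧-orderTheoreticLattice public
    using (_≤_; x∧y≤x; x∧y≤y; ∧-greatest; x≤x∨y; y≤x∨y; ∨-least)
    renaming (refl to ≤-refl; trans to ≤-trans; reflexive to ≤-reflexive; antisym to ≤-antisym)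
  open MeetSemilatticeProperties (OrderLattice.Lattice.meetSemilattice ∨-∧-orderTheoreticLattice)
    public using (∧-monotonic)
  open import Relation.Binary.Reasoning.PartialOrder poset

  x≤⊤ : ∀ {x} → x ≤ ⊤
  x≤⊤ {x} = sym (∧-identityʳ x)

  ⊤≤⇒≈⊤ : ∀ {x} → ⊤ ≤ x → x ≈ ⊤
  ⊤≤⇒≈⊤ ⊤≤x = ≤-antisym x≤⊤ ⊤≤x

  modus-ponens : ∀ {a x y} → a ≤ x → a ≤ ¬ x ∨ y → a ≤ y
  modus-ponens {a} {x} {y} a≤x a≤x⟶y = begin
    a               ≤⟨ ∧-greatest a≤x a≤x⟶y ⟩
    x ∧ (¬ x ∨ y)   ≈⟨ ∧-distribˡ-∨ x (¬ x) y ⟩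
    x ∧ ¬ x ∨ x ∧ y ≈⟨ ∨-congʳ (∧-complementʳ x) ⟩
    ⊥ ∨ x ∧ y       ≈⟨ ∨-identityˡ (x ∧ y) ⟩
    x ∧ y           ≤⟨ x∧y≤y x y ⟩
    y               ∎

  ⊤≤⟶⇒≤ : ∀ {x y} → ⊤ ≤ ¬ x ∨ y → x ≤ y
  ⊤≤⟶⇒≤ ⊤≤x⟶y = modus-ponens ≤-refl (≤-trans x≤⊤ ⊤≤x⟶y)

  ≤⇒⟶≈⊤ : ∀ {x y} → x ≤ y → ¬ x ∨ y ≈ ⊤
  ≤⇒⟶≈⊤ {x} {y} x≤y = ⊤≤⇒≈⊤ (begin
    ⊤       ≈⟨ ∨-complementˡ x ⟨
    ¬ x ∨ x ≤⟨ ∨-least (x≤x∨y (¬ x) y) (≤-trans x≤y (y≤x∨y (¬ x) y)) ⟩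
    ¬ x ∨ y ∎)

  by-cases : ∀ {x y z} → z ∧ x ≤ y → ¬ z ∧ x ≤ y → x ≤ y
  by-cases {x} {y} {z} z∧x≤y ¬z∧x≤y = begin
    x               ≈⟨ ∧-identityˡ x ⟨
    ⊤ ∧ x           ≈⟨ ∧-congʳ (∨-complementʳ z) ⟨
    (z ∨ ¬ z) ∧ x   ≈⟨ ∧-distribʳ-∨ x z (¬ z) ⟩
    z ∧ x ∨ ¬ z ∧ x ≤⟨ ∨-least z∧x≤y ¬z∧x≤y ⟩
    y               ∎

module BooleanSemantics {c ℓ : Level} (B : BooleanAlgebra c ℓ) where
  open BooleanAlgebra B
  open BooleanAlgebraProperties B using (¬⊥≈⊤; ¬-involutive; deMorgan₁; deMorgan₂)
  open BooleanOrder B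
  open import Relation.Binary.Reasoning.PartialOrder poset

  eval : (Formula → Carrier) → Formula → Carrier
  eval ρ (var n)  = ρ (var n)
  eval ρ (φ ∧' ψ) = eval ρ φ ∧ eval ρ ψ
  eval ρ (φ ∨' ψ) = eval ρ φ ∨ eval ρ ψ
  eval ρ (φ ⇒ ψ)  = ¬ eval ρ φ ∨ eval ρ ψ
  eval ρ (φ □→ ψ) = ρ (φ □→ ψ)
  eval ρ 𝟘        = ⊥
  eval ρ 𝟙        = ⊤

  literal : Bool → Carrier → Carrier
  literal true  x = x
  literal false x = ¬ x

  literal-∧ : ∀ a b {x y} → literal a x ∧ literal b y ≤ literal (a ∧ᵇ b) (x ∧ y)
  literal-∧ true  true          = ≤-refl
  literal-∧ true  false {x} {y} =
    ≤-trans (x∧y≤y _ _) (≤-trans (y≤x∨y (¬ x) (¬ y)) (≤-reflexive (sym (deMorgan₁ x y))))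
  literal-∧ false _     {x} {y} =
    ≤-trans (x∧y≤x _ _) (≤-trans (x≤x∨y (¬ x) (¬ y)) (≤-reflexive (sym (deMorgan₁ x y))))

  literal-∨ : ∀ a b {x y} → literal a x ∧ literal b y ≤ literal (a ∨ᵇ b) (x ∨ y)
  literal-∨ true  _             = ≤-trans (x∧y≤x _ _) (x≤x∨y _ _)
  literal-∨ false true          = ≤-trans (x∧y≤y _ _) (y≤x∨y _ _)
  literal-∨ false false {x} {y} = ≤-reflexive (sym (deMorgan₂ x y))

  literal-¬ : ∀ a {x} → literal a x ≤ literal (not a) (¬ x)
  literal-¬ true  {x} = ≤-reflexive (sym (¬-involutive x))
  literal-¬ false     = ≤-refl

  module _ (ρ : Formula → Carrier) where

    literal-eval  : ∀ {c} v φ → (∀ {α} → α ∈ atoms φ → c ≤ literal (v α) (ρ α))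
                  → c ≤ literal (evalB v φ) (eval ρ φ)
    literal-eval₂ : ∀ {c} v φ ψ → (∀ {α} → α ∈ atoms φ ++ atoms ψ → c ≤ literal (v α) (ρ α))
                  → c ≤ literal (evalB v φ) (eval ρ φ) ∧ literal (evalB v ψ) (eval ρ ψ)

    literal-eval v (var n)  c≤atoms = c≤atoms (here ≡.refl)
    literal-eval v (φ □→ ψ) c≤atoms = c≤atoms (here ≡.refl)
    literal-eval v (φ ∧' ψ) c≤atoms =
      ≤-trans (literal-eval₂ v φ ψ c≤atoms) (literal-∧ (evalB v φ) (evalB v ψ))
    literal-eval v (φ ∨' ψ) c≤atoms =
      ≤-trans (literal-eval₂ v φ ψ c≤atoms) (literal-∨ (evalB v φ) (evalB v ψ))
    literal-eval v (φ ⇒ ψ)  c≤atoms =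
      ≤-trans (literal-eval₂ v φ ψ c≤atoms)
        (≤-trans (∧-monotonic (literal-¬ (evalB v φ)) ≤-refl) (literal-∨ (not (evalB v φ)) (evalB v ψ)))
    literal-eval v 𝟘        _       = ≤-trans x≤⊤ (≤-reflexive (sym ¬⊥≈⊤))
    literal-eval v 𝟙        _       = x≤⊤

    literal-eval₂ v φ ψ c≤atoms =
      ∧-greatest (literal-eval v φ (c≤atoms ∘ ∈-++⁺ˡ)) (literal-eval v ψ (c≤atoms ∘ ∈-++⁺ʳ (atoms φ)))

    minterm : (Formula → Bool) → List Formula → Carrier
    minterm v []       = ⊤
    minterm v (α ∷ As) = literal (v α) (ρ α) ∧ minterm v As

    minterm≤literal : ∀ {v α As} → α ∈ As → minterm v As ≤ literal (v α) (ρ α)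
    minterm≤literal (here ≡.refl) = x∧y≤x _ _
    minterm≤literal (there α∈As)  = ≤-trans (x∧y≤y _ _) (minterm≤literal α∈As)

    literal-[≔]-same : ∀ v α b → literal b (ρ α) ≤ literal ((v [ α ≔ b ]) α) (ρ α)
    literal-[≔]-same v α b with α ≟ α
    ... | yes _  = ≤-refl
    ... | no α≢α = contradiction ≡.refl α≢α

    literal-[≔] : ∀ v α b β → literal b (ρ α) ∧ literal (v β) (ρ β) ≤ literal ((v [ α ≔ b ]) β) (ρ β)
    literal-[≔] v α b β with β ≟ α
    ... | yes ≡.refl = x∧y≤x _ _
    ... | no _       = x∧y≤y _ _

    minterm-[≔] : ∀ v α b As → literal b (ρ α) ∧ minterm v As ≤ minterm (v [ α ≔ b ]) As
    minterm-[≔] v α b []       = x≤⊤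
    minterm-[≔] v α b (β ∷ As) = ∧-greatest
      (≤-trans (∧-monotonic ≤-refl (x∧y≤x _ _)) (literal-[≔] v α b β))
      (≤-trans (∧-monotonic ≤-refl (x∧y≤y _ _)) (minterm-[≔] v α b As))

    minterms-cover : ∀ {y} As → (∀ v → minterm v As ≤ y) → ⊤ ≤ y
    minterms-cover     []       minterms≤y = minterms≤y (λ _ → true)
    minterms-cover {y} (α ∷ As) minterms≤y =
      minterms-cover As λ v → by-cases (split v true) (split v false)
      where
      split : ∀ v b → literal b (ρ α) ∧ minterm v As ≤ y
      split v b = begin
        literal b (ρ α) ∧ minterm v As
          ≤⟨ ∧-greatest (≤-trans (x∧y≤x _ _) (literal-[≔]-same v α b)) (minterm-[≔] v α b As) ⟩
        minterm (v [ α ≔ b ]) (α ∷ As)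
          ≤⟨ minterms≤y (v [ α ≔ b ]) ⟩
        y ∎

    tautology≈⊤ : ∀ φ → Tautology φ → eval ρ φ ≈ ⊤
    tautology≈⊤ φ ⊨φ = ⊤≤⇒≈⊤ (minterms-cover (atoms φ) λ v →
      ≡.subst (λ b → minterm v (atoms φ) ≤ literal b (eval ρ φ)) (⊨φ v) (literal-eval v φ minterm≤literal))

module Soundness {c ℓ : Level} (A : VAlgebra c ℓ) where
  open VAlgebra A hiding (_≤_)
  -- This _≤_ is x ≈ x ∧ y, the symmetric form of VAlgebra._≤_ used in V2 and in _⊨≤[_,_]_.
  open BooleanOrder boolAlg
  open BooleanSemantics boolAlg using (eval; tautology≈⊤)
  open BooleanAlgebraProperties boolAlg using (∧-identityʳ)

  ⟦⟧-eval : ∀ φ h → ⟦ A ⟧ φ h ≡ eval (λ α → ⟦ A ⟧ α h) φ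
  ⟦⟧-eval (var n)  h = ≡.refl
  ⟦⟧-eval (φ ∧' ψ) h = ≡.cong₂ _∧_ (⟦⟧-eval φ h) (⟦⟧-eval ψ h)
  ⟦⟧-eval (φ ∨' ψ) h = ≡.cong₂ _∨_ (⟦⟧-eval φ h) (⟦⟧-eval ψ h)
  ⟦⟧-eval (φ ⇒ ψ)  h = ≡.cong₂ _⟶_ (⟦⟧-eval φ h) (⟦⟧-eval ψ h)
  ⟦⟧-eval (φ □→ ψ) h = ≡.refl
  ⟦⟧-eval 𝟘        h = ≡.refl
  ⟦⟧-eval 𝟙        h = ≡.refl

  ⟦⟧-tautology≈⊤ : ∀ φ {h} → Tautology φ → ⟦ A ⟧ φ h ≈ ⊤
  ⟦⟧-tautology≈⊤ φ {h} ⊨φ =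
    ≡.subst (_≈ ⊤) (≡.sym (⟦⟧-eval φ h)) (tautology≈⊤ (λ α → ⟦ A ⟧ α h) φ ⊨φ)

  ≈⊤⇒≤ : ∀ {a x} → x ≈ ⊤ → a ≤ x
  ≈⊤⇒≤ x≈⊤ = ≤-trans x≤⊤ (≤-reflexive (sym x≈⊤))

  ≈⇒⟷≈⊤ : ∀ {x y} → x ≈ y → x ⟷ y ≈ ⊤
  ≈⇒⟷≈⊤ x≈y =
    trans (∧-cong (≤⇒⟶≈⊤ (≤-reflexive x≈y)) (≤⇒⟶≈⊤ (≤-reflexive (sym x≈y)))) (∧-identityʳ ⊤)

  ⊡-monoʳ : ∀ z {x y} → x ≤ y → z ⊡ x ≤ z ⊡ y
  ⊡-monoʳ z {x} {y} x≤y = trans (⊡-cong refl x≤y) (V4 z x y)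

  sound : ∀ {Γ φ h a} → (∀ {γ} → Γ γ → a ≤ ⟦ A ⟧ γ h) → Γ ⊢ φ → a ≤ ⟦ A ⟧ φ h
  sound a≤Γ (hyp Γγ)      = a≤Γ Γγ
  sound a≤Γ (taut {φ} ⊨φ) = ≈⊤⇒≤ (⟦⟧-tautology≈⊤ φ ⊨φ)
  sound a≤Γ (L1 φ)        = ≈⊤⇒≤ (V1 _)
  sound a≤Γ (L2 φ ψ γ)    = ≈⊤⇒≤ (≤⇒⟶≈⊤ (sym (V2 _ _ _)))
  sound a≤Γ (L3 φ ψ γ)    = ≈⊤⇒≤ (V3 _ _ _)
  sound a≤Γ (L4 φ ψ γ)    = ≈⊤⇒≤ (≈⇒⟷≈⊤ (V4 _ _ _))
  sound a≤Γ (mp ⊢φ ⊢φ⇒ψ)  = modus-ponens (sound a≤Γ ⊢φ) (sound a≤Γ ⊢φ⇒ψ)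
  sound a≤Γ (weak γ ⊢φ⇒ψ) = ≈⊤⇒≤ (≤⇒⟶≈⊤ (⊡-monoʳ _ (⊤≤⟶⇒≤ (sound (λ ()) ⊢φ⇒ψ))))

⊢⇒⊨≤ : ∀ {c ℓ Γ φ} → Γ ⊢ φ → Γ ⊨≤[ c , ℓ ] φ
⊢⇒⊨≤ ⊢φ A h a a≤Γ = sym (sound (λ {γ} Γγ → sym (a≤Γ γ Γγ)) ⊢φ)
  where
  open Soundness A
  open VAlgebra A using (sym)

⊢-mono : ∀ {Γ Δ φ} → Γ ⊆ Δ → Γ ⊢ φ → Δ ⊢ φ
⊢-mono Γ⊆Δ (hyp Γφ)      = hyp (Γ⊆Δ Γφ)
⊢-mono Γ⊆Δ (taut ⊨φ)     = taut ⊨φ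
⊢-mono Γ⊆Δ (L1 φ)        = L1 φ
⊢-mono Γ⊆Δ (L2 φ ψ γ)    = L2 φ ψ γ
⊢-mono Γ⊆Δ (L3 φ ψ γ)    = L3 φ ψ γ
⊢-mono Γ⊆Δ (L4 φ ψ γ)    = L4 φ ψ γ
⊢-mono Γ⊆Δ (mp ⊢φ ⊢φ⇒ψ)  = mp (⊢-mono Γ⊆Δ ⊢φ) (⊢-mono Γ⊆Δ ⊢φ⇒ψ)
⊢-mono Γ⊆Δ (weak γ ⊢φ⇒ψ) = weak γ ⊢φ⇒ψ

⊢-sub : ∀ σ {φ} → ∅ ⊢ φ → ∅ ⊢ sub σ φ
⊢-sub σ (hyp ())
⊢-sub σ (taut {φ} ⊨φ)  = taut (Tautology-sub σ {φ} ⊨φ)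
⊢-sub σ (L1 φ)         = L1 _
⊢-sub σ (L2 φ ψ γ)     = L2 _ _ _
⊢-sub σ (L3 φ ψ γ)     = L3 _ _ _
⊢-sub σ (L4 φ ψ γ)     = L4 _ _ _
⊢-sub σ (mp ⊢φ ⊢φ⇒ψ)   = mp (⊢-sub σ ⊢φ) (⊢-sub σ ⊢φ⇒ψ)
⊢-sub σ (weak γ ⊢φ⇒ψ)  = weak _ (⊢-sub σ ⊢φ⇒ψ)

module TautologicalReasoning {D : Formula → Set}
  (taut : ∀ {φ} → Tautology φ → D φ) (mp : ∀ {φ ψ} → D φ → D (φ ⇒ ψ) → D ψ) where

  tautology-instance : ∀ {k} P (xs : Vec Formula k) {_ : BoxFree P} {_ : T (truthTableValid k P)}
                     → D (sub ⟨ xs ⟩ P)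
  tautology-instance P xs {boxFree} {table} = taut (tautology P xs {boxFree} {table})

  mp₂ : ∀ {φ ψ χ} → D φ → D ψ → D (φ ⇒ ψ ⇒ χ) → D χ
  mp₂ Dφ Dψ Dφ⇒ψ⇒χ = mp Dψ (mp Dφ Dφ⇒ψ⇒χ)

  ∧-intro : ∀ {φ ψ} → D φ → D ψ → D (φ ∧' ψ)
  ∧-intro Dφ Dψ = mp₂ Dφ Dψ (tautology-instance (p₀ ⇒ p₁ ⇒ (p₀ ∧' p₁)) (_ ∷ _ ∷ []))

  ∧-elimˡ : ∀ {φ ψ} → D (φ ∧' ψ) → D φ
  ∧-elimˡ Dφ∧ψ = mp Dφ∧ψ (tautology-instance ((p₀ ∧' p₁) ⇒ p₀) (_ ∷ _ ∷ []))

  ∧-elimʳ : ∀ {φ ψ} → D (φ ∧' ψ) → D ψ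
  ∧-elimʳ Dφ∧ψ = mp Dφ∧ψ (tautology-instance ((p₀ ∧' p₁) ⇒ p₁) (_ ∷ _ ∷ []))

  ⇒-∧ˡ : ∀ {φ ψ χ} → D (φ ⇒ ψ ∧' χ) → D (φ ⇒ ψ)
  ⇒-∧ˡ Dφ⇒ψ∧χ = mp Dφ⇒ψ∧χ (tautology-instance ((p₀ ⇒ p₁ ∧' p₂) ⇒ (p₀ ⇒ p₁)) (_ ∷ _ ∷ _ ∷ []))

  ⇒-∧ʳ : ∀ {φ ψ χ} → D (φ ⇒ ψ ∧' χ) → D (φ ⇒ χ)
  ⇒-∧ʳ Dφ⇒ψ∧χ = mp Dφ⇒ψ∧χ (tautology-instance ((p₀ ⇒ p₁ ∧' p₂) ⇒ (p₀ ⇒ p₂)) (_ ∷ _ ∷ _ ∷ []))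

  ⇔-refl : ∀ {φ} → D (φ ⇔ φ)
  ⇔-refl = tautology-instance (p₀ ⇔ p₀) (_ ∷ [])

  ⇔-sym : ∀ {φ ψ} → D (φ ⇔ ψ) → D (ψ ⇔ φ)
  ⇔-sym Dφ⇔ψ = ∧-intro (∧-elimʳ Dφ⇔ψ) (∧-elimˡ Dφ⇔ψ)

  ⇔-trans : ∀ {φ ψ χ} → D (φ ⇔ ψ) → D (ψ ⇔ χ) → D (φ ⇔ χ)
  ⇔-trans Dφ⇔ψ Dψ⇔χ =
    mp₂ Dφ⇔ψ Dψ⇔χ (tautology-instance ((p₀ ⇔ p₁) ⇒ (p₁ ⇔ p₂) ⇒ (p₀ ⇔ p₂)) (_ ∷ _ ∷ _ ∷ []))

module LV {Γ : Pred Formula 0ℓ} = TautologicalReasoning {Γ ⊢_} taut mp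

-- Unlike in LV, the rule applies to every consequence of the premises, not only to theorems;
-- this makes ≋ below a congruence for □→.
infix 3 _⊢ᵍ_
data _⊢ᵍ_ (S : Pred Formula 0ℓ) : Formula → Set where
  hyp  : ∀ {φ} → S φ → S ⊢ᵍ φ
  thm  : ∀ {φ} → ∅ ⊢ φ → S ⊢ᵍ φ
  mp   : ∀ {φ ψ} → S ⊢ᵍ φ → S ⊢ᵍ φ ⇒ ψ → S ⊢ᵍ ψ
  weak : ∀ {φ ψ} γ → S ⊢ᵍ φ ⇒ ψ → S ⊢ᵍ (γ □→ φ) ⇒ (γ □→ ψ)

-- p₀ does not occur in the shifted premises and stands for the degree of truth.
data Guarded (Γ : Pred Formula 0ℓ) : Pred Formula 0ℓ where
  guard : ∀ {γ} → Γ γ → Guarded Γ (p₀ ⇒ ↑ γ)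

-- χ is the conjunction of the premises the derivation uses; anything below it may replace p₀.
localize : ∀ {Γ ψ} → Guarded Γ ⊢ᵍ ψ
         → Σ[ χ ∈ Formula ] Γ ⊢ χ × (∀ θ → ∅ ⊢ θ ⇒ χ → ∅ ⊢ sub (fill θ) ψ)
localize (hyp (guard {γ} Γγ)) =
  γ , hyp Γγ , λ θ ⊢θ⇒γ → ≡.subst (λ γ' → ∅ ⊢ θ ⇒ γ') (≡.sym (fill-↑ θ γ)) ⊢θ⇒γ
localize (thm ⊢ψ) =
  𝟙 , taut (λ _ → ≡.refl) , λ θ _ → ⊢-sub (fill θ) ⊢ψ
localize (mp ⊢φ ⊢φ⇒ψ) with localize ⊢φ | localize ⊢φ⇒ψ
... | χ₁ , Γ⊢χ₁ , instantiate₁ | χ₂ , Γ⊢χ₂ , instantiate₂ =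
  χ₁ ∧' χ₂ , LV.∧-intro Γ⊢χ₁ Γ⊢χ₂ , λ θ ⊢θ⇒χ₁∧χ₂ →
    mp (instantiate₁ θ (LV.⇒-∧ˡ ⊢θ⇒χ₁∧χ₂)) (instantiate₂ θ (LV.⇒-∧ʳ ⊢θ⇒χ₁∧χ₂))
localize (weak γ ⊢φ⇒ψ) with localize ⊢φ⇒ψ
... | χ , Γ⊢χ , instantiate = χ , Γ⊢χ , λ θ ⊢θ⇒χ → weak _ (instantiate θ ⊢θ⇒χ)

module Lindenbaum (c ℓ : Level) (S : Pred Formula 0ℓ) where
  open TautologicalReasoning {S ⊢ᵍ_} (thm ∘ taut) mp

  _≋_ : Formula → Formula → Set
  φ ≋ ψ = S ⊢ᵍ φ ⇔ ψ

  ∧'-cong : ∀ {φ φ' ψ ψ'} → φ ≋ φ' → ψ ≋ ψ' → (φ ∧' ψ) ≋ (φ' ∧' ψ')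
  ∧'-cong φ≋φ' ψ≋ψ' = mp₂ φ≋φ' ψ≋ψ'
    (tautology-instance ((p₀ ⇔ p₁) ⇒ (p₂ ⇔ p₃) ⇒ ((p₀ ∧' p₂) ⇔ (p₁ ∧' p₃))) (_ ∷ _ ∷ _ ∷ _ ∷ []))

  ∨'-cong : ∀ {φ φ' ψ ψ'} → φ ≋ φ' → ψ ≋ ψ' → (φ ∨' ψ) ≋ (φ' ∨' ψ')
  ∨'-cong φ≋φ' ψ≋ψ' = mp₂ φ≋φ' ψ≋ψ'
    (tautology-instance ((p₀ ⇔ p₁) ⇒ (p₂ ⇔ p₃) ⇒ ((p₀ ∨' p₂) ⇔ (p₁ ∨' p₃))) (_ ∷ _ ∷ _ ∷ _ ∷ []))

  ⇒𝟘-cong : ∀ {φ φ'} → φ ≋ φ' → (φ ⇒ 𝟘) ≋ (φ' ⇒ 𝟘)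
  ⇒𝟘-cong φ≋φ' = mp φ≋φ' (tautology-instance ((p₀ ⇔ p₁) ⇒ ((p₀ ⇒ 𝟘) ⇔ (p₁ ⇒ 𝟘))) (_ ∷ _ ∷ []))

  □→-cong : ∀ {φ φ' ψ ψ'} → φ ≋ φ' → ψ ≋ ψ' → (φ □→ ψ) ≋ (φ' □→ ψ')
  □→-cong {φ} {φ'} {ψ} φ≋φ' ψ≋ψ' = ⇔-trans
    (mp (∧-intro φ□→φ' φ'□→φ) (thm (L2 φ φ' ψ)))
    (∧-intro (weak φ' (∧-elimˡ ψ≋ψ')) (weak φ' (∧-elimʳ ψ≋ψ')))
    where
    φ□→φ' : S ⊢ᵍ φ □→ φ'
    φ□→φ' = mp (thm (L1 φ)) (weak φ (∧-elimˡ φ≋φ'))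
    φ'□→φ : S ⊢ᵍ φ' □→ φ
    φ'□→φ = mp (thm (L1 φ')) (weak φ' (∧-elimʳ φ≋φ'))

  Carrier : Set c
  Carrier = Lift c Formula

  _≈_ : Carrier → Carrier → Set ℓ
  x ≈ y = Lift ℓ (lower x ≋ lower y)

  ≈-tautology : ∀ {k} P (xs : Vec Carrier k) {_ : BoxFree P} {_ : T (truthTableValid k P)}
              → Lift ℓ (S ⊢ᵍ sub ⟨ map lower xs ⟩ P)
  ≈-tautology P xs {boxFree} {table} = lift (tautology-instance P (map lower xs) {boxFree} {table})

  booleanAlgebra : BooleanAlgebra c ℓ
  booleanAlgebra = record
    { Carrier = Carrier
    ; _≈_     = _≈_
    ; _∨_     = λ x y → lift (lower x ∨' lower y)
    ; _∧_     = λ x y → lift (lower x ∧' lower y)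
    ; ¬_      = λ x → lift (lower x ⇒ 𝟘)
    ; ⊤       = lift 𝟙
    ; ⊥       = lift 𝟘
    ; isBooleanAlgebra = record
      { isDistributiveLattice = record
        { isLattice = record
          { isEquivalence = record
            { refl  = lift ⇔-refl
            ; sym   = λ x≈y → lift (⇔-sym (lower x≈y))
            ; trans = λ x≈y y≈z → lift (⇔-trans (lower x≈y) (lower y≈z))
            }
          ; ∨-comm     = λ x y → ≈-tautology ((p₀ ∨' p₁) ⇔ (p₁ ∨' p₀)) (x ∷ y ∷ [])
          ; ∨-assoc    = λ x y z →
              ≈-tautology (((p₀ ∨' p₁) ∨' p₂) ⇔ (p₀ ∨' (p₁ ∨' p₂))) (x ∷ y ∷ z ∷ [])
          ; ∨-cong     = λ x≈x' y≈y' → lift (∨'-cong (lower x≈x') (lower y≈y'))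
          ; ∧-comm     = λ x y → ≈-tautology ((p₀ ∧' p₁) ⇔ (p₁ ∧' p₀)) (x ∷ y ∷ [])
          ; ∧-assoc    = λ x y z →
              ≈-tautology (((p₀ ∧' p₁) ∧' p₂) ⇔ (p₀ ∧' (p₁ ∧' p₂))) (x ∷ y ∷ z ∷ [])
          ; ∧-cong     = λ x≈x' y≈y' → lift (∧'-cong (lower x≈x') (lower y≈y'))
          ; absorptive = (λ x y → ≈-tautology ((p₀ ∨' (p₀ ∧' p₁)) ⇔ p₀) (x ∷ y ∷ []))
                       , (λ x y → ≈-tautology ((p₀ ∧' (p₀ ∨' p₁)) ⇔ p₀) (x ∷ y ∷ []))
          }
        ; ∨-distrib-∧ =
            (λ x y z → ≈-tautology ((p₀ ∨' (p₁ ∧' p₂)) ⇔ ((p₀ ∨' p₁) ∧' (p₀ ∨' p₂))) (x ∷ y ∷ z ∷ []))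
          , (λ x y z → ≈-tautology (((p₁ ∧' p₂) ∨' p₀) ⇔ ((p₁ ∨' p₀) ∧' (p₂ ∨' p₀))) (x ∷ y ∷ z ∷ []))
        ; ∧-distrib-∨ =
            (λ x y z → ≈-tautology ((p₀ ∧' (p₁ ∨' p₂)) ⇔ ((p₀ ∧' p₁) ∨' (p₀ ∧' p₂))) (x ∷ y ∷ z ∷ []))
          , (λ x y z → ≈-tautology (((p₁ ∨' p₂) ∧' p₀) ⇔ ((p₁ ∧' p₀) ∨' (p₂ ∧' p₀))) (x ∷ y ∷ z ∷ []))
        }
      ; ∨-complement = (λ x → ≈-tautology (((p₀ ⇒ 𝟘) ∨' p₀) ⇔ 𝟙) (x ∷ []))
                     , (λ x → ≈-tautology ((p₀ ∨' (p₀ ⇒ 𝟘)) ⇔ 𝟙) (x ∷ []))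
      ; ∧-complement = (λ x → ≈-tautology (((p₀ ⇒ 𝟘) ∧' p₀) ⇔ 𝟘) (x ∷ []))
                     , (λ x → ≈-tautology ((p₀ ∧' (p₀ ⇒ 𝟘)) ⇔ 𝟘) (x ∷ []))
      ; ¬-cong = λ x≈y → lift (⇒𝟘-cong (lower x≈y))
      }
    }

  vAlgebra : VAlgebra c ℓ
  vAlgebra = record
    { boolAlg = booleanAlgebra
    ; _⊡_     = λ x y → lift (lower x □→ lower y)
    ; ⊡-cong  = λ x≈x' y≈y' → lift (□→-cong (lower x≈x') (lower y≈y'))
    ; V1      = λ x → lift (mp (thm (L1 (lower x))) (tautology-instance (p₀ ⇒ (p₀ ⇔ 𝟙)) (_ ∷ [])))
    ; V2      = λ x y z → lift (mp (thm (L2 (lower x) (lower y) (lower z))) (tautology-instance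
                  ((p₀ ⇒ (p₁ ⇔ p₂)) ⇒ ((p₀ ∧' (((p₁ ⇒ 𝟘) ∨' p₂) ∧' ((p₂ ⇒ 𝟘) ∨' p₁))) ⇔ p₀))
                  (_ ∷ _ ∷ _ ∷ [])))
    ; V3      = λ x y z → lift (mp (thm (L3 (lower x) (lower y) (lower z))) (tautology-instance
                  ((p₀ ∨' (p₁ ⇔ p₂)) ⇒ ((p₀ ∨' (((p₁ ⇒ 𝟘) ∨' p₂) ∧' ((p₂ ⇒ 𝟘) ∨' p₁))) ⇔ 𝟙))
                  (_ ∷ _ ∷ _ ∷ [])))
    ; V4      = λ x y z → lift (thm (L4 (lower x) (lower y) (lower z)))
    }

  ⟦⟧-sub : ∀ σ φ → lower (⟦ vAlgebra ⟧ φ (lift ∘ σ)) ≋ sub σ φ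
  ⟦⟧-sub σ (var n)  = ⇔-refl
  ⟦⟧-sub σ (φ ∧' ψ) = ∧'-cong (⟦⟧-sub σ φ) (⟦⟧-sub σ ψ)
  ⟦⟧-sub σ (φ ∨' ψ) = ∨'-cong (⟦⟧-sub σ φ) (⟦⟧-sub σ ψ)
  ⟦⟧-sub σ (φ ⇒ ψ)  = ⇔-trans (∨'-cong (⇒𝟘-cong (⟦⟧-sub σ φ)) (⟦⟧-sub σ ψ))
                              (tautology-instance (((p₀ ⇒ 𝟘) ∨' p₁) ⇔ (p₀ ⇒ p₁)) (_ ∷ _ ∷ []))
  ⟦⟧-sub σ (φ □→ ψ) = □→-cong (⟦⟧-sub σ φ) (⟦⟧-sub σ ψ)
  ⟦⟧-sub σ 𝟘        = ⇔-refl
  ⟦⟧-sub σ 𝟙        = ⇔-refl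

  ⊢-to-≤ : ∀ {φ} σ ψ → S ⊢ᵍ φ ⇒ sub σ ψ → VAlgebra._≤_ vAlgebra (lift φ) (⟦ vAlgebra ⟧ ψ (lift ∘ σ))
  ⊢-to-≤ σ ψ ⊢φ⇒ψ = lift (⇔-trans (∧'-cong ⇔-refl (⟦⟧-sub σ ψ))
    (mp ⊢φ⇒ψ (tautology-instance ((p₀ ⇒ p₁) ⇒ ((p₀ ∧' p₁) ⇔ p₀)) (_ ∷ _ ∷ []))))

  ≤-to-⊢ : ∀ {φ} σ ψ → VAlgebra._≤_ vAlgebra (lift φ) (⟦ vAlgebra ⟧ ψ (lift ∘ σ)) → S ⊢ᵍ φ ⇒ sub σ ψ
  ≤-to-⊢ σ ψ φ≤ψ = mp (⇔-trans (∧'-cong ⇔-refl (⇔-sym (⟦⟧-sub σ ψ))) (lower φ≤ψ))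
    (tautology-instance (((p₀ ∧' p₁) ⇔ p₀) ⇒ (p₀ ⇒ p₁)) (_ ∷ _ ∷ []))

⊨≤⇒guarded : ∀ {c ℓ Γ φ} → Γ ⊨≤[ c , ℓ ] φ → Guarded Γ ⊢ᵍ p₀ ⇒ ↑ φ
⊨≤⇒guarded {c} {ℓ} {Γ} {φ} ⊨φ =
  ≤-to-⊢ shift φ (⊨φ vAlgebra (lift ∘ shift) (lift p₀) λ γ Γγ → ⊢-to-≤ shift γ (hyp (guard Γγ)))
  where
  open Lindenbaum c ℓ (Guarded Γ)
  shift : ℕ → Formula
  shift = var ∘ suc

guarded⇒⊢ : ∀ {Γ φ} → Guarded Γ ⊢ᵍ p₀ ⇒ ↑ φ → Γ ⊢ φ
guarded⇒⊢ {φ = φ} ⊢p⇒φ with localize ⊢p⇒φ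
... | χ , Γ⊢χ , instantiate = mp Γ⊢χ (⊢-mono (λ ()) ∅⊢χ⇒φ)
  where
  ∅⊢χ⇒φ : ∅ ⊢ χ ⇒ φ
  ∅⊢χ⇒φ = ≡.subst (λ ψ → ∅ ⊢ χ ⇒ ψ) (fill-↑ χ φ)
            (instantiate χ (LV.tautology-instance (p₀ ⇒ p₀) (χ ∷ [])))

⊨≤⇒⊢ : ∀ {c ℓ Γ φ} → Γ ⊨≤[ c , ℓ ] φ → Γ ⊢ φ
⊨≤⇒⊢ {φ = φ} ⊨φ = guarded⇒⊢ (⊨≤⇒guarded {φ = φ} ⊨φ)

theorem4p15 : ∀ {c ℓ : Level} (Γ : Pred Formula 0ℓ) (φ : Formula)
    → ((Γ ⊢ φ) → (Γ ⊨≤[ c , ℓ ] φ)) × ((Γ ⊨≤[ c , ℓ ] φ) → (Γ ⊢ φ))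
theorem4p15 Γ φ = ⊢⇒⊨≤ , ⊨≤⇒⊢
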